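{- Let $P$ be a dealing pattern, $N\ge 1$, and let $P'$ be the pattern obtained from $P$ by deleting its first $N$ letters. Then for every $k$ with $d_k(P)\le N$ we have $T^P_{N,d_k(P)}=k$, and for every $k$ with $u_k(P)\le N$ we have \[T^{P}_{N,u_k(P)}=T^{P'}_{|P_N|_U,\,k}+|P_N|_D.\]
   Context: A dealing pattern $P=P_1P_2P_3\cdots$ is an infinite sequence of letters $U$ and $D$ containing infinitely many $D$'s. Dealing a deck of $N$ cards (positions $1,\dots,N$ from the top) by $P$ means: process the letters in order; for a $U$ move the top card to the bottom; for a $D$ remove the top card (deal it); stop when all $N$ cards are dealt. The dealing triangle is defined by: for $1\le k\le N$, $T^P_{N,k}$ is the number $j$ such that the card initially at position $k$ is the $j$th card dealt. $d_i(P)$ and $u_i(P)$ denote the index (starting from 1) of the $i$th occurrence of $D$, resp. $U$, in $P$. $|P_m|_D$, $|P_m|_U$ denote the number of $D$'s, resp. $U$'s, among the first $m$ letters of $P$. -}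

module Defs where

open import Data.Nat using (ℕ; zero; suc; _+_; _∸_; _≤_; _≡ᵇ_)
open import Data.Nat.Properties using (≤-trans; m≤m+n; m∸n+n≡m; +-comm; ∸-monoˡ-≤; m+n∸m≡n)
open import Data.List using (List; []; _∷_; _++_; [_]; map; upTo)
open import Data.Product using (Σ; ∃; _×_; _,_; proj₁; proj₂)
open import Data.Bool using (if_then_else_)
open import Relation.Binary.PropositionalEquality using (_≡_; refl; sym; subst; cong)

data Letter : Set where
  U D : Letter

-- A dealing pattern: infinite sequence of letters (seq i is the letter P_{i+1},
-- i.e. 0-based storage of the 1-based sequence P_1 P_2 ...) with infinitely many D's.
record DealingPattern : Set where
  field
    seq  : ℕ → Letter
    infD : ∀ n → Σ ℕ λ m → n ≤ m × seq m ≡ D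
open DealingPattern public

countD : (ℕ → Letter) → ℕ → ℕ
countD p zero = zero
countD p (suc m) with p m
... | D = suc (countD p m)
... | U = countD p m

countU : (ℕ → Letter) → ℕ → ℕ
countU p zero = zero
countU p (suc m) with p m
... | U = suc (countU p m)
... | D = countU p m

IsDIndex : DealingPattern → ℕ → ℕ → Set
IsDIndex P k i = Σ ℕ λ m → (i ≡ suc m) × (seq P m ≡ D) × (countD (seq P) (suc m) ≡ k)

IsUIndex : DealingPattern → ℕ → ℕ → Set
IsUIndex P k i = Σ ℕ λ m → (i ≡ suc m) × (seq P m ≡ U) × (countU (seq P) (suc m) ≡ k)

dropPattern : ℕ → DealingPattern → DealingPattern
dropPattern N P = record
  { seq  = λ i → seq P (N + i)
  ; infD = λ n → let w = infD P (N + n)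
                     m = proj₁ w
                     N≤m : N ≤ m
                     N≤m = ≤-trans (m≤m+n N n) (proj₁ (proj₂ w))
                     eq : N + (m ∸ N) ≡ m
                     eq = subst (λ x → x ≡ m) (+-comm (m ∸ N) N) (m∸n+n≡m N≤m)
                 in (m ∸ N)
                    , subst (λ x → x ≤ m ∸ N) (m+n∸m≡n N n) (∸-monoˡ-≤ N (proj₁ (proj₂ w)))
                    , subst (λ x → seq P x ≡ D) (sym eq) (proj₂ (proj₂ w))
  }

-- Dealing simulation. State: (remaining deck top-first, cards dealt so far in order).
State : Set
State = List ℕ × List ℕ

step : Letter → State → State
step _ ([] , dealt) = ([] , dealt)
step U (x ∷ xs , dealt) = (xs ++ [ x ] , dealt)
step D (x ∷ xs , dealt) = (xs , dealt ++ [ x ])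

-- State after processing the first m letters (once the deck is empty nothing changes,
-- which corresponds to having stopped).
run : (ℕ → Letter) → ℕ → State → State
run p zero s = s
run p (suc m) s = run (λ i → p (suc i)) m (step (p zero) s)

-- A number of letters after which at least n D's have been processed
-- (uses the infinitely-many-D witness n times), so a deck of n cards is fully dealt.
fuel : DealingPattern → ℕ → ℕ
fuel P zero = zero
fuel P (suc n) = suc (proj₁ (infD P (fuel P n)))

deck : ℕ → List ℕ
deck N = map suc (upTo N)

-- 1-based position of k in a list (0 if absent).
indexOf : ℕ → List ℕ → ℕ
indexOf k [] = zero
indexOf k (x ∷ xs) = if x ≡ᵇ k then 1 else suc (indexOf k xs)

-- Dealing triangle: T P N k = j iff the card initially at position k is the j-th card dealt.
T : DealingPattern → ℕ → ℕ → ℕ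
T P N k = indexOf k (proj₂ (run (seq P) (fuel P N) (deck N , [])))

{-# OPTIONS --safe #-}
module Submission where

-- Each of the first N letters of P handles a different card of the deck: the i-th letter
-- meets card i on top, because the cards moved to the bottom queue up behind the untouched
-- ones. So after N letters card d_k has been dealt k-th, and the remaining deck is the list
-- u_1, …, u_M of the M = |P_N|_U cards met by a U, in this order. From then on P' deals these
-- M cards exactly as it deals a fresh deck 1, …, M, after the |P_N|_D cards already dealt.

open import Defs
open import Data.Nat using (ℕ; zero; suc; _+_; _∸_; _≤_; _<_; _≤′_; ≤′-refl; ≤′-step; z≤n; _≟_; _≡ᵇ_)
open import Data.Nat.Properties
  using (≤-refl; ≤-reflexive; ≤-trans; <-irrefl; n≤1+n; n<1+n; m<n⇒m<1+n; ≤⇒≤′; +-comm; +-suc;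
         +-identityʳ; suc-injective; ∸-monoˡ-≤; ∸-+-assoc; m+[n∸m]≡n; m≤n⇒m∸n≡0; module ≤-Reasoning)
open import Data.Bool using (true; false; if_then_else_)
open import Data.List using (List; []; _∷_; _++_; _∷ʳ_; [_]; map; length; upTo)
open import Data.List.Properties
  using (++-assoc; ++-identityʳ; length-++; length-map; length-upTo; map-++; map-∘; map-cong-local; map-upTo)
open import Data.List.Membership.Propositional using (_∈_; _∉_)
open import Data.List.Membership.Propositional.Properties using (∈-++⁺ˡ; ∈-++⁺ʳ; ∈-++⁻)
open import Data.List.Relation.Unary.Any using (here; there)
open import Data.List.Relation.Unary.All as All using (All; []; _∷_)
import Data.List.Relation.Unary.All.Properties as All
open import Data.List.Relation.Unary.Unique.Propositional using (Unique; []; _∷_)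
import Data.List.Relation.Unary.Unique.Propositional.Properties as Unique
open import Data.Product as Product using (∃; _×_; _,_; proj₁; proj₂; map₂)
open import Data.Sum using (inj₁; inj₂)
open import Function using (_∘_)
open import Relation.Binary.PropositionalEquality using (_≡_; _≢_; refl; sym; trans; cong; cong₂; subst; module ≡-Reasoning)
open import Relation.Nullary using (Dec; yes; no; does; contradiction)
open import Relation.Nullary.Decidable using (dec-true; dec-false)

length-∷ʳ : ∀ (xs : List ℕ) x → length (xs ∷ʳ x) ≡ suc (length xs)
length-∷ʳ xs x = trans (length-++ xs) (+-comm (length xs) 1)

deck-suc : ∀ n → deck (suc n) ≡ 1 ∷ map suc (deck n)
deck-suc n = cong (1 ∷_) (cong (map suc) (sym (map-upTo suc n)))

length-deck : ∀ n → length (deck n) ≡ n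
length-deck n = trans (length-map suc (upTo n)) (length-upTo n)

-- `does (x ≟ k)` computes to `x ≡ᵇ k`, the test performed by indexOf.
indexOf-head : ∀ k xs → indexOf k (k ∷ xs) ≡ 1
indexOf-head k xs = cong (if_then 1 else suc (indexOf k xs)) (dec-true (k ≟ k) refl)

indexOf-tail : ∀ {x k} xs → x ≢ k → indexOf k (x ∷ xs) ≡ suc (indexOf k xs)
indexOf-tail {x} {k} xs x≢k = cong (if_then 1 else suc (indexOf k xs)) (dec-false (x ≟ k) x≢k)

indexOf-nonzero : ∀ {k} xs → k ∈ xs → indexOf k xs ≢ 0
indexOf-nonzero {k} (x ∷ xs) _ with x ≡ᵇ k
... | true  = λ ()
... | false = λ ()

∈-tail : ∀ {x k} {xs : List ℕ} → x ≢ k → k ∈ x ∷ xs → k ∈ xs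
∈-tail x≢k (here k≡x) = contradiction (sym k≡x) x≢k
∈-tail x≢k (there k∈) = k∈

indexOf-++-∈ : ∀ {k} xs ys → k ∈ xs → indexOf k (xs ++ ys) ≡ indexOf k xs
indexOf-++-∈ {k} (x ∷ xs) ys k∈ with x ≟ k
... | yes refl = trans (indexOf-head x (xs ++ ys)) (sym (indexOf-head x xs))
... | no x≢k   = begin
  indexOf k (x ∷ xs ++ ys)   ≡⟨ indexOf-tail (xs ++ ys) x≢k ⟩
  suc (indexOf k (xs ++ ys)) ≡⟨ cong suc (indexOf-++-∈ xs ys (∈-tail x≢k k∈)) ⟩
  suc (indexOf k xs)         ≡⟨ indexOf-tail xs x≢k ⟨
  indexOf k (x ∷ xs)         ∎
  where open ≡-Reasoning

indexOf-++-∉ : ∀ {k} xs ys → k ∉ xs → indexOf k (xs ++ ys) ≡ length xs + indexOf k ys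
indexOf-++-∉ []       ys k∉ = refl
indexOf-++-∉ (x ∷ xs) ys k∉ =
  trans (indexOf-tail (xs ++ ys) (k∉ ∘ here ∘ sym)) (cong suc (indexOf-++-∉ xs ys (k∉ ∘ there)))

indexOf-∷ʳ : ∀ {k} xs → k ∉ xs → indexOf k (xs ∷ʳ k) ≡ length (xs ∷ʳ k)
indexOf-∷ʳ {k} xs k∉ = begin
  indexOf k (xs ∷ʳ k)          ≡⟨ indexOf-++-∉ xs [ k ] k∉ ⟩
  length xs + indexOf k [ k ]  ≡⟨ cong (length xs +_) (indexOf-head k []) ⟩
  length xs + 1                ≡⟨ length-++ xs ⟨
  length (xs ∷ʳ k)             ∎
  where open ≡-Reasoning

indexOf-head≢ : ∀ {x k} xs → x ≢ k → k ∈ x ∷ xs → indexOf x (x ∷ xs) ≢ indexOf k (x ∷ xs)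
indexOf-head≢ {x} {k} xs x≢k k∈ eq = indexOf-nonzero xs (∈-tail x≢k k∈) (suc-injective (begin
  suc (indexOf k xs)  ≡⟨ indexOf-tail xs x≢k ⟨
  indexOf k (x ∷ xs)  ≡⟨ eq ⟨
  indexOf x (x ∷ xs)  ≡⟨ indexOf-head x xs ⟩
  1                   ∎))
  where open ≡-Reasoning

indexOf-injective : ∀ {x y} xs → x ∈ xs → y ∈ xs → indexOf x xs ≡ indexOf y xs → x ≡ y
indexOf-injective {x} {y} (z ∷ xs) x∈ y∈ eq with z ≟ x | z ≟ y
... | yes refl | yes refl = refl
... | yes refl | no z≢y   = contradiction eq (indexOf-head≢ xs z≢y y∈)
... | no z≢x   | yes refl = contradiction (sym eq) (indexOf-head≢ xs z≢x x∈)
... | no z≢x   | no z≢y   = indexOf-injective xs (∈-tail z≢x x∈) (∈-tail z≢y y∈)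
  (suc-injective (trans (sym (indexOf-tail xs z≢x)) (trans eq (indexOf-tail xs z≢y))))

indexOf-map : ∀ (f : ℕ → ℕ) {k} xs → (∀ {y} → y ∈ xs → f y ≡ f k → y ≡ k) →
              indexOf (f k) (map f xs) ≡ indexOf k xs
indexOf-map f     []       _   = refl
indexOf-map f {k} (x ∷ xs) inj with x ≟ k
... | yes refl = trans (indexOf-head (f x) (map f xs)) (sym (indexOf-head x xs))
... | no x≢k   = begin
  indexOf (f k) (f x ∷ map f xs)  ≡⟨ indexOf-tail (map f xs) (x≢k ∘ inj (here refl)) ⟩
  suc (indexOf (f k) (map f xs))  ≡⟨ cong suc (indexOf-map f xs (inj ∘ there)) ⟩
  suc (indexOf k xs)              ≡⟨ indexOf-tail xs x≢k ⟨
  indexOf k (x ∷ xs)              ∎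
  where open ≡-Reasoning

map-indexOf-self : ∀ {xs} → Unique xs → map (λ y → indexOf y xs) xs ≡ deck (length xs)
map-indexOf-self {[]}     []          = refl
map-indexOf-self {x ∷ xs} (x∉ ∷ uniq) = begin
  indexOf x (x ∷ xs) ∷ map (λ y → indexOf y (x ∷ xs)) xs
    ≡⟨ cong₂ _∷_ (indexOf-head x xs) (map-cong-local (All.map (indexOf-tail xs) x∉)) ⟩
  1 ∷ map (suc ∘ λ y → indexOf y xs) xs      ≡⟨ cong (1 ∷_) (map-∘ xs) ⟩
  1 ∷ map suc (map (λ y → indexOf y xs) xs)  ≡⟨ cong (λ ys → 1 ∷ map suc ys) (map-indexOf-self uniq) ⟩
  1 ∷ map suc (deck (length xs))             ≡⟨ deck-suc (length xs) ⟨
  deck (suc (length xs))                     ∎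
  where open ≡-Reasoning

run-suc : ∀ p m s → run p (suc m) s ≡ step (p m) (run p m s)
run-suc p zero    s = refl
run-suc p (suc m) s = run-suc (λ i → p (suc i)) m (step (p zero) s)

run-+ : ∀ p m n s → run p (m + n) s ≡ run (λ i → p (m + i)) n (run p m s)
run-+ p zero    n s = refl
run-+ p (suc m) n s = run-+ (λ i → p (suc i)) m n (step (p zero) s)

run-commute : (φ : State → State) → (∀ l s → step l (φ s) ≡ φ (step l s)) →
              ∀ p m s → run p m (φ s) ≡ φ (run p m s)
run-commute φ comm p zero    s = refl
run-commute φ comm p (suc m) s =
  trans (cong (run (λ i → p (suc i)) m) (comm (p zero) s)) (run-commute φ comm (λ i → p (suc i)) m (step (p zero) s))

run-invariant : (I : State → Set) → (∀ l s → I s → I (step l s)) → ∀ p m s → I s → I (run p m s)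
run-invariant I pres p zero    s Is = Is
run-invariant I pres p (suc m) s Is = run-invariant I pres (λ i → p (suc i)) m (step (p zero) s) (pres (p zero) s Is)

run-[] : ∀ p m {s} → proj₁ s ≡ [] → run p m s ≡ s
run-[] p zero    _    = refl
run-[] p (suc m) refl = run-[] (λ i → p (suc i)) m refl

run-exhausted-≡ : ∀ p m n s → proj₁ (run p m s) ≡ [] → proj₁ (run p n s) ≡ [] → run p m s ≡ run p n s
run-exhausted-≡ p m n s empty-m empty-n = begin
  run p m s                            ≡⟨ run-[] (λ i → p (m + i)) n empty-m ⟨
  run (λ i → p (m + i)) n (run p m s)  ≡⟨ run-+ p m n s ⟨
  run p (m + n) s                      ≡⟨ cong (λ k → run p k s) (+-comm m n) ⟩
  run p (n + m) s                      ≡⟨ run-+ p n m s ⟩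
  run (λ i → p (n + i)) m (run p n s)  ≡⟨ run-[] (λ i → p (n + i)) m empty-n ⟩
  run p n s                            ∎
  where open ≡-Reasoning

prependDealt : List ℕ → State → State
prependDealt ds = map₂ (ds ++_)

step-prependDealt : ∀ ds l s → step l (prependDealt ds s) ≡ prependDealt ds (step l s)
step-prependDealt ds _ ([]    , es) = refl
step-prependDealt ds U (_ ∷ _ , es) = refl
step-prependDealt ds D (x ∷ _ , es) = cong (_ ,_) (++-assoc ds es [ x ])

relabel : (ℕ → ℕ) → State → State
relabel f = Product.map (map f) (map f)

step-relabel : ∀ f l s → step l (relabel f s) ≡ relabel f (step l s)
step-relabel f _ ([]     , ds) = refl
step-relabel f U (x ∷ xs , ds) = cong (_, map f ds) (sym (map-++ f xs [ x ]))
step-relabel f D (x ∷ xs , ds) = cong (map f xs ,_) (sym (map-++ f ds [ x ]))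

AllCards : (ℕ → Set) → State → Set
AllCards Q (xs , ds) = All Q xs × All Q ds

step-AllCards : ∀ {Q} l s → AllCards Q s → AllCards Q (step l s)
step-AllCards _ ([]     , ds) all              = all
step-AllCards U (x ∷ xs , ds) (Qx ∷ Qxs , Qds) = All.++⁺ Qxs (Qx ∷ []) , Qds
step-AllCards D (x ∷ xs , ds) (Qx ∷ Qxs , Qds) = Qxs , All.++⁺ Qds (Qx ∷ [])

dealt-⊆-deck : ∀ p m xs → All (_∈ xs) (proj₂ (run p m (xs , [])))
dealt-⊆-deck p m xs =
  proj₂ (run-invariant (AllCards (_∈ xs)) step-AllCards p m (xs , []) (All.tabulate (λ x∈ → x∈) , []))

-- Dealing commutes with relabelling the cards, and ranking the cards of a duplicate-free
-- deck xs by their position turns it into deck (length xs).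
indexOf-dealt-rank : ∀ p m {xs x} → Unique xs → x ∈ xs →
  indexOf x (proj₂ (run p m (xs , []))) ≡ indexOf (indexOf x xs) (proj₂ (run p m (deck (length xs) , [])))
indexOf-dealt-rank p m {xs} {x} uniq x∈ = begin
  indexOf x dealt                      ≡⟨ indexOf-map rank dealt rank-injective ⟨
  indexOf (rank x) (map rank dealt)    ≡⟨ cong (indexOf (rank x) ∘ proj₂) ranked ⟩
  indexOf (rank x) (proj₂ (run p m (deck (length xs) , [])))  ∎
  where
  open ≡-Reasoning
  rank : ℕ → ℕ
  rank y = indexOf y xs
  dealt : List ℕ
  dealt = proj₂ (run p m (xs , []))
  rank-injective : ∀ {y} → y ∈ dealt → rank y ≡ rank x → y ≡ x
  rank-injective y∈ = indexOf-injective xs (All.lookup (dealt-⊆-deck p m xs) y∈) x∈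
  ranked : relabel rank (run p m (xs , [])) ≡ run p m (deck (length xs) , [])
  ranked = trans (sym (run-commute (relabel rank) (step-relabel rank) p m (xs , [])))
                 (cong (λ d → run p m (d , [])) (map-indexOf-self uniq))

deckSize : State → ℕ
deckSize = length ∘ proj₁

step-deckSize-≤ : ∀ l s → deckSize (step l s) ≤ deckSize s
step-deckSize-≤ _ ([]     , _) = z≤n
step-deckSize-≤ U (x ∷ xs , _) = ≤-reflexive (length-∷ʳ xs x)
step-deckSize-≤ D (x ∷ xs , _) = n≤1+n (length xs)

step-D-deckSize : ∀ s → deckSize (step D s) ≡ deckSize s ∸ 1
step-D-deckSize ([]    , _) = refl
step-D-deckSize (_ ∷ _ , _) = refl

run-deckSize-antitone : ∀ p {m n} s → m ≤ n → deckSize (run p n s) ≤ deckSize (run p m s)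
run-deckSize-antitone p {m} {n} s m≤n = begin
  deckSize (run p n s)                              ≡⟨ cong (λ k → deckSize (run p k s)) (m+[n∸m]≡n m≤n) ⟨
  deckSize (run p (m + (n ∸ m)) s)                  ≡⟨ cong deckSize (run-+ p m (n ∸ m) s) ⟩
  deckSize (run (λ i → p (m + i)) (n ∸ m) (run p m s))
    ≤⟨ run-invariant (λ t → deckSize t ≤ deckSize (run p m s)) (λ l t → ≤-trans (step-deckSize-≤ l t))
                     (λ i → p (m + i)) (n ∸ m) (run p m s) ≤-refl ⟩
  deckSize (run p m s)                              ∎
  where open ≤-Reasoning

fuel-deckSize : ∀ P n s → deckSize (run (seq P) (fuel P n) s) ≤ deckSize s ∸ n
fuel-deckSize P zero    s = ≤-refl
fuel-deckSize P (suc n) s with infD P (fuel P n)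
... | m , fuel≤m , pm≡D = begin
  deckSize (run p (suc m) s)         ≡⟨ cong deckSize (run-suc p m s) ⟩
  deckSize (step (p m) (run p m s))  ≡⟨ cong (λ l → deckSize (step l (run p m s))) pm≡D ⟩
  deckSize (step D (run p m s))      ≡⟨ step-D-deckSize (run p m s) ⟩
  deckSize (run p m s) ∸ 1           ≤⟨ ∸-monoˡ-≤ 1 (run-deckSize-antitone p s fuel≤m) ⟩
  deckSize (run p (fuel P n) s) ∸ 1  ≤⟨ ∸-monoˡ-≤ 1 (fuel-deckSize P n s) ⟩
  deckSize s ∸ n ∸ 1                 ≡⟨ ∸-+-assoc (deckSize s) n 1 ⟩
  deckSize s ∸ (n + 1)               ≡⟨ cong (deckSize s ∸_) (+-comm n 1) ⟩
  deckSize s ∸ suc n                 ∎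
  where
  p : ℕ → Letter
  p = seq P
  open ≤-Reasoning

fuel-exhausts : ∀ P n s → deckSize s ≤ n → proj₁ (run (seq P) (fuel P n) s) ≡ []
fuel-exhausts P n s size≤n = length≤0 (≤-trans (fuel-deckSize P n s) (≤-reflexive (m≤n⇒m∸n≡0 size≤n)))
  where
  length≤0 : ∀ {xs : List ℕ} → length xs ≤ 0 → xs ≡ []
  length≤0 {[]} _ = refl

_≟ᴸ_ : (a b : Letter) → Dec (a ≡ b)
U ≟ᴸ U = yes refl
U ≟ᴸ D = no λ ()
D ≟ᴸ U = no λ ()
D ≟ᴸ D = yes refl

-- positions D p n lists d₁(P) < d₂(P) < … up to n, and positions U p n likewise the u_k(P).
positions : Letter → (ℕ → Letter) → ℕ → List ℕ
positions l p zero    = []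
positions l p (suc n) = if does (p n ≟ᴸ l) then positions l p n ∷ʳ suc n else positions l p n

module _ {l : Letter} {p : ℕ → Letter} where

  positions-match : ∀ {m} → p m ≡ l → positions l p (suc m) ≡ positions l p m ∷ʳ suc m
  positions-match {m} pm≡l with p m ≟ᴸ l
  ... | yes _    = refl
  ... | no pm≢l = contradiction pm≡l pm≢l

  positions-prefix : ∀ {m n} → m ≤′ n → ∃ λ rest → positions l p n ≡ positions l p m ++ rest
  positions-prefix ≤′-refl = [] , sym (++-identityʳ _)
  positions-prefix {m} {suc n} (≤′-step m≤′n) with positions-prefix m≤′n | p n ≟ᴸ l
  ... | rest , eq | no _  = rest , eq
  ... | rest , eq | yes _ = rest ∷ʳ suc n , (begin
    positions l p n ∷ʳ suc n           ≡⟨ cong (_∷ʳ suc n) eq ⟩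
    (positions l p m ++ rest) ∷ʳ suc n ≡⟨ ++-assoc (positions l p m) rest [ suc n ] ⟩
    positions l p m ++ rest ∷ʳ suc n   ∎)
    where open ≡-Reasoning

  ∈-positions⁻ : ∀ {m n} → suc m ∈ positions l p n → m < n × p m ≡ l
  ∈-positions⁻ {m} {suc n} m∈ with p n ≟ᴸ l
  ... | no _ = Product.map₁ m<n⇒m<1+n (∈-positions⁻ m∈)
  ... | yes pn≡l with ∈-++⁻ (positions l p n) m∈
  ...   | inj₁ m∈′          = Product.map₁ m<n⇒m<1+n (∈-positions⁻ m∈′)
  ...   | inj₂ (here refl) = n<1+n n , pn≡l

  suc-∉-positions : ∀ n → suc n ∉ positions l p n
  suc-∉-positions n n∈ = <-irrefl refl (proj₁ (∈-positions⁻ n∈))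

  positions-split : ∀ {m n} → m < n → p m ≡ l → ∃ λ rest → positions l p n ≡ (positions l p m ∷ʳ suc m) ++ rest
  positions-split m<n pm≡l with positions-prefix (≤⇒≤′ m<n)
  ... | rest , eq = rest , trans eq (cong (_++ rest) (positions-match pm≡l))

  ∈-positions⁺ : ∀ {m n} → m < n → p m ≡ l → suc m ∈ positions l p n
  ∈-positions⁺ {m} m<n pm≡l with positions-split m<n pm≡l
  ... | rest , eq = subst (suc m ∈_) (sym eq) (∈-++⁺ˡ (∈-++⁺ʳ (positions l p m) (here refl)))

  indexOf-positions : ∀ {m n} → m < n → p m ≡ l → indexOf (suc m) (positions l p n) ≡ length (positions l p (suc m))
  indexOf-positions {m} {n} m<n pm≡l with positions-split m<n pm≡l
  ... | rest , eq = begin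
    indexOf (suc m) (positions l p n)               ≡⟨ cong (indexOf (suc m)) eq ⟩
    indexOf (suc m) ((positions l p m ∷ʳ suc m) ++ rest)
      ≡⟨ indexOf-++-∈ (positions l p m ∷ʳ suc m) rest (∈-++⁺ʳ (positions l p m) (here refl)) ⟩
    indexOf (suc m) (positions l p m ∷ʳ suc m)      ≡⟨ indexOf-∷ʳ (positions l p m) (suc-∉-positions m) ⟩
    length (positions l p m ∷ʳ suc m)               ≡⟨ cong length (positions-match pm≡l) ⟨
    length (positions l p (suc m))                  ∎
    where open ≡-Reasoning

  positions-unique : ∀ n → Unique (positions l p n)
  positions-unique zero    = []
  positions-unique (suc n) with p n ≟ᴸ l
  ... | no _  = positions-unique n
  ... | yes _ = Unique.++⁺ (positions-unique n) ([] ∷ []) λ { (n∈ , here refl) → suc-∉-positions n n∈ }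

length-positions-D : ∀ p n → length (positions D p n) ≡ countD p n
length-positions-D p zero    = refl
length-positions-D p (suc n) with p n
... | D = trans (length-∷ʳ (positions D p n) (suc n)) (cong suc (length-positions-D p n))
... | U = length-positions-D p n

length-positions-U : ∀ p n → length (positions U p n) ≡ countU p n
length-positions-U p zero    = refl
length-positions-U p (suc n) with p n
... | U = trans (length-∷ʳ (positions U p n) (suc n)) (cong suc (length-positions-U p n))
... | D = length-positions-U p n

interval : ℕ → ℕ → List ℕ
interval j zero    = []
interval j (suc r) = suc j ∷ interval (suc j) r

interval-suc : ∀ j r → interval (suc j) r ≡ map suc (interval j r)
interval-suc j zero    = refl
interval-suc j (suc r) = cong (suc (suc j) ∷_) (interval-suc (suc j) r)

deck-interval : ∀ n → deck n ≡ interval 0 n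
deck-interval zero    = refl
deck-interval (suc n) =
  trans (deck-suc n) (cong (1 ∷_) (trans (cong (map suc) (deck-interval n)) (sym (interval-suc 0 n))))

step-top : ∀ p j xs → step (p j) (suc j ∷ xs ++ positions U p j , positions D p j)
                      ≡ (xs ++ positions U p (suc j) , positions D p (suc j))
step-top p j xs with p j
... | U = cong (_, positions D p j) (++-assoc xs (positions U p j) [ suc j ])
... | D = refl

run-interval : ∀ p j r → run p j (interval 0 (j + r) , []) ≡ (interval j r ++ positions U p j , positions D p j)
run-interval p zero    r = cong (_, []) (sym (++-identityʳ _))
run-interval p (suc j) r = begin
  run p (suc j) (interval 0 (suc j + r) , [])         ≡⟨ run-suc p j _ ⟩
  step (p j) (run p j (interval 0 (suc j + r) , []))
    ≡⟨ cong (λ n → step (p j) (run p j (interval 0 n , []))) (+-suc j r) ⟨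
  step (p j) (run p j (interval 0 (j + suc r) , []))
    ≡⟨ cong (step (p j)) (run-interval p j (suc r)) ⟩
  step (p j) (suc j ∷ interval (suc j) r ++ positions U p j , positions D p j)
    ≡⟨ step-top p j (interval (suc j) r) ⟩
  (interval (suc j) r ++ positions U p (suc j) , positions D p (suc j))  ∎
  where open ≡-Reasoning

run-deck : ∀ p n → run p n (deck n , []) ≡ (positions U p n , positions D p n)
run-deck p n = trans (cong (λ d → run p n (d , [])) deck≡interval) (run-interval p n 0)
  where
  deck≡interval : deck n ≡ interval 0 (n + 0)
  deck≡interval = trans (deck-interval n) (cong (interval 0) (sym (+-identityʳ n)))

module AfterPrefix (P : DealingPattern) (N : ℕ) where

  p : ℕ → Letter
  p = seq P

  P′ : DealingPattern
  P′ = dropPattern N P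

  M : ℕ
  M = countU p N

  Ds Us : List ℕ
  Ds = positions D p N
  Us = positions U p N

  run′ : List ℕ → State
  run′ xs = run (seq P′) (fuel P′ M) (xs , [])

  run-prefix-then-P′ : run p (N + fuel P′ M) (deck N , []) ≡ (proj₁ (run′ Us) , Ds ++ proj₂ (run′ Us))
  run-prefix-then-P′ = begin
    run p (N + fuel P′ M) (deck N , [])               ≡⟨ run-+ p N (fuel P′ M) _ ⟩
    run (seq P′) (fuel P′ M) (run p N (deck N , []))  ≡⟨ cong (run (seq P′) (fuel P′ M)) (run-deck p N) ⟩
    run (seq P′) (fuel P′ M) (Us , Ds)
      ≡⟨ cong (λ ds → run (seq P′) (fuel P′ M) (Us , ds)) (++-identityʳ Ds) ⟨
    run (seq P′) (fuel P′ M) (prependDealt Ds (Us , []))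
      ≡⟨ run-commute (prependDealt Ds) (step-prependDealt Ds) (seq P′) (fuel P′ M) (Us , []) ⟩
    prependDealt Ds (run′ Us)                         ∎
    where open ≡-Reasoning

  dealt-split : proj₂ (run p (fuel P N) (deck N , [])) ≡ Ds ++ proj₂ (run′ Us)
  dealt-split = cong proj₂ (trans exhausted-runs-agree run-prefix-then-P′)
    where
    deck-exhausted : proj₁ (run p (fuel P N) (deck N , [])) ≡ []
    deck-exhausted = fuel-exhausts P N (deck N , []) (≤-reflexive (length-deck N))
    P′-exhausted : proj₁ (run p (N + fuel P′ M) (deck N , [])) ≡ []
    P′-exhausted = trans (cong proj₁ run-prefix-then-P′)
                         (fuel-exhausts P′ M (Us , []) (≤-reflexive (length-positions-U p N)))
    exhausted-runs-agree : run p (fuel P N) (deck N , []) ≡ run p (N + fuel P′ M) (deck N , [])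
    exhausted-runs-agree = run-exhausted-≡ p (fuel P N) (N + fuel P′ M) (deck N , []) deck-exhausted P′-exhausted

  indexOf-run′ : ∀ {m} → m < N → p m ≡ U → indexOf (suc m) (proj₂ (run′ Us)) ≡ T P′ M (countU p (suc m))
  indexOf-run′ {m} m<N pm≡U = begin
    indexOf (suc m) (proj₂ (run′ Us))
      ≡⟨ indexOf-dealt-rank (seq P′) (fuel P′ M) (positions-unique N) (∈-positions⁺ m<N pm≡U) ⟩
    indexOf (indexOf (suc m) Us) (proj₂ (run′ (deck (length Us))))
      ≡⟨ cong₂ (λ j n → indexOf j (proj₂ (run′ (deck n)))) rank≡count (length-positions-U p N) ⟩
    T P′ M (countU p (suc m))  ∎
    where
    open ≡-Reasoning
    rank≡count : indexOf (suc m) Us ≡ countU p (suc m)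
    rank≡count = trans (indexOf-positions m<N pm≡U) (length-positions-U p (suc m))

  T-dealt : ∀ {m} → m < N → p m ≡ D → T P N (suc m) ≡ countD p (suc m)
  T-dealt {m} m<N pm≡D = begin
    indexOf (suc m) (proj₂ (run p (fuel P N) (deck N , [])))  ≡⟨ cong (indexOf (suc m)) dealt-split ⟩
    indexOf (suc m) (Ds ++ proj₂ (run′ Us))  ≡⟨ indexOf-++-∈ Ds (proj₂ (run′ Us)) (∈-positions⁺ m<N pm≡D) ⟩
    indexOf (suc m) Ds                       ≡⟨ indexOf-positions m<N pm≡D ⟩
    length (positions D p (suc m))           ≡⟨ length-positions-D p (suc m) ⟩
    countD p (suc m)                         ∎
    where open ≡-Reasoning

  T-undealt : ∀ {m} → m < N → p m ≡ U → T P N (suc m) ≡ T P′ M (countU p (suc m)) + countD p N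
  T-undealt {m} m<N pm≡U = begin
    indexOf (suc m) (proj₂ (run p (fuel P N) (deck N , [])))  ≡⟨ cong (indexOf (suc m)) dealt-split ⟩
    indexOf (suc m) (Ds ++ proj₂ (run′ Us))        ≡⟨ indexOf-++-∉ Ds (proj₂ (run′ Us)) not-dealt ⟩
    length Ds + indexOf (suc m) (proj₂ (run′ Us))  ≡⟨ cong₂ _+_ (length-positions-D p N) (indexOf-run′ m<N pm≡U) ⟩
    countD p N + T P′ M (countU p (suc m))         ≡⟨ +-comm (countD p N) _ ⟩
    T P′ M (countU p (suc m)) + countD p N         ∎
    where
    open ≡-Reasoning
    not-dealt : suc m ∉ Ds
    not-dealt m∈ with () ← trans (sym pm≡U) (proj₂ (∈-positions⁻ {D} {p} {n = N} m∈))

mainTheorem4 : (P : DealingPattern) (N : ℕ) → 1 ≤ N →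
    ((k i : ℕ) → IsDIndex P k i → i ≤ N → T P N i ≡ k)
    × ((k i : ℕ) → IsUIndex P k i → i ≤ N →
         T P N i ≡ T (dropPattern N P) (countU (seq P) N) k + countD (seq P) N)
mainTheorem4 P N _ = dealt-index , undealt-index
  where
  open AfterPrefix P N

  dealt-index : (k i : ℕ) → IsDIndex P k i → i ≤ N → T P N i ≡ k
  dealt-index k _ (m , refl , pm≡D , countD≡k) m<N = trans (T-dealt m<N pm≡D) countD≡k

  undealt-index : (k i : ℕ) → IsUIndex P k i → i ≤ N → T P N i ≡ T P′ M k + countD p N
  undealt-index k _ (m , refl , pm≡U , countU≡k) m<N =
    trans (T-undealt m<N pm≡U) (cong (λ j → T P′ M j + countD p N) countU≡k)
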